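{- Let $w=11122322221$, $w^*=111223^*22221$ and $$j_1=m\left(\overline{21}\,1232321212112221\,w\,w\,w^*\,w\,11121\,\overline{12}\right).$$ Suppose $B\in\{1,2,3\}^{\mathbb{Z}}$ satisfies $B=22221\,w^*\,11122$ and $m(B)<j_1$. Then $B=2221\,w\,w^*\,w\,11122$.
   Context: For a bi-infinite sequence $B=(b_n)_{n\in\mathbb{Z}}$ of positive integers, $\lambda_k(B)=[b_k;b_{k+1},\dots]+[0;b_{k-1},b_{k-2},\dots]$ and $m(B)=\sup_k\lambda_k(B)$. For a finite word $u=u_{ -p}\dots u_0^*\dots u_q$ with one starred letter, "$B=u$" means $(b_{ -p},\dots,b_q)=(u_{ -p},\dots,u_q)$. In the expression for $j_1$, the starred letter is at position $0$, $\overline{21}$ at the left denotes $\dots2121$ repeated infinitely to the left and $\overline{12}$ at the right denotes $1212\dots$ repeated infinitely to the right. -}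

module Defs where

open import Data.Nat using (ℕ; zero; suc; _+_; _*_; _∸_; _≤_; _<_; _%_; _<?_)
open import Relation.Nullary using (yes; no)
open import Data.Integer as ℤ using (ℤ; +_; -[1+_])
open import Data.List using (List; []; _∷_; _++_; map; upTo; length; lookup)
open import Data.Fin using (Fin; toℕ)
open import Data.Product using (_×_; _,_; Σ; ∃; ∃-syntax)
open import Relation.Binary.PropositionalEquality using (_≡_)

Seq : Set
Seq = ℤ → ℕ

w : List ℕ
w = 1 ∷ 1 ∷ 1 ∷ 2 ∷ 2 ∷ 3 ∷ 2 ∷ 2 ∷ 2 ∷ 2 ∷ 1 ∷ []

-- "B = u" for a finite word u whose starred letter is u[s]:
-- (b_{-s}, …, b_{|u|-1-s}) = u, i.e. b_{i-s} = u[i] for every index i of u.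
Matches : Seq → List ℕ → ℕ → Set
Matches B u s = (i : Fin (length u)) → B (+ toℕ i ℤ.- + s) ≡ lookup u i

In123 : Seq → Set
In123 B = (n : ℤ) → (1 ≤ B n) × (B n ≤ 3)

-- The sequence defining j₁:  \overline{21} M \overline{12}
-- with M = 1232321212112221 w w w* w 11121, star at index 16+11+11+5 = 43.

M : List ℕ
M = (1 ∷ 2 ∷ 3 ∷ 2 ∷ 3 ∷ 2 ∷ 1 ∷ 2 ∷ 1 ∷ 2 ∷ 1 ∷ 1 ∷ 2 ∷ 2 ∷ 2 ∷ 1 ∷ [])
    ++ w ++ w ++ w ++ w ++ (1 ∷ 1 ∷ 1 ∷ 2 ∷ 1 ∷ [])

nthOr : ℕ → List ℕ → ℕ → ℕ
nthOr d []       _       = d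
nthOr d (x ∷ xs) zero    = x
nthOr d (x ∷ xs) (suc n) = nthOr d xs n

-- entry at integer position j of  …2121 M 1212…  (M occupying positions 0 … |M|-1)
Jpos : ℤ → ℕ
Jpos -[1+ n ] with n % 2
... | zero  = 1
... | suc _ = 2
Jpos (+ n) with n <? length M
... | yes _ = nthOr 0 M n
... | no _ with (n ∸ length M) % 2
...   | zero  = 1
...   | suc _ = 2

-- J with the starred letter (index 43 of M) at position 0
J : Seq
J i = Jpos (i ℤ.+ + 43)

-- [a₀; a₁, …, aₙ] as a pair (p , q) meaning p / q  (cf [] = 1/0 = ∞ is
-- only the base of the recursion: cf (a ∷ []) = (a , 1)).
cf : List ℕ → ℕ × ℕ
cf []      = 1 , 0
cf (a ∷ r) with cf r
... | p , q = a * p + q , p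

fwd : Seq → ℤ → ℕ → List ℕ
fwd B k m = map (λ i → B (k ℤ.+ + i)) (upTo m)

bwd : Seq → ℤ → ℕ → List ℕ
bwd B k m = map (λ i → B (k ℤ.- + suc i)) (upTo m)

-- n-th lower approximant of λ_k(B):
--   [b_k; b_{k+1}, …, b_{k+2n}] + [0; b_{k-1}, …, b_{k-2n-2}]
-- Both truncations are lower bounds of the respective infinite continued
-- fractions, they increase with n and converge, so their sum increases to λ_k(B).
lowerλ : Seq → ℤ → ℕ → ℕ × ℕ
lowerλ B k n with cf (fwd B k (suc (2 * n))) | cf (bwd B k (2 + 2 * n))
... | p₁ , q₁ | p₂ , q₂ = p₁ * p₂ + q₁ * q₂ , q₁ * p₂

_≤q_ : ℕ × ℕ → ℕ × ℕ → Set
(a , b) ≤q (c , d) = a * d ≤ c * b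

_<q_ : ℕ × ℕ → ℕ × ℕ → Set
(a , b) <q (c , d) = a * d < c * b

-- λ_k(B) ≤ r   (limit of an increasing sequence is ≤ r iff all terms are)
λ≤ : Seq → ℤ → ℕ × ℕ → Set
λ≤ B k r = ∀ n → lowerλ B k n ≤q r

<λ : ℕ × ℕ → Seq → ℤ → Set
<λ r B k = ∃[ n ] (r <q lowerλ B k n)

-- m(B) < m(C), where m = sup_k λ_k : there is a rational r ≥ 0 with
-- λ_k(B) ≤ r for all k and r < λ_k(C) for some k.
mLess : Seq → Seq → Set
mLess B C = ∃[ c ] ∃[ d ] ((1 ≤ d) × ((k : ℤ) → λ≤ B k (c , d)) × ∃[ k ] <λ (c , d) C k)

-- Words in the statement
-- hypothesis word: 22221 w* 11122 (star at index 5 + 5 = 10)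
hypWord : List ℕ
hypWord = (2 ∷ 2 ∷ 2 ∷ 2 ∷ 1 ∷ []) ++ w ++ (1 ∷ 1 ∷ 1 ∷ 2 ∷ 2 ∷ [])

-- conclusion word: 2221 w w* w 11122 (star at index 4 + 11 + 5 = 20)
concWord : List ℕ
concWord = (2 ∷ 2 ∷ 2 ∷ 1 ∷ []) ++ w ++ w ++ w ++ (1 ∷ 1 ∷ 1 ∷ 2 ∷ 2 ∷ [])

-- The hypothesis mLess B J is first turned into a bound of every truncation of every λ_k(B) by one
-- truncation of λ_0(J): J attains its Markov value at the star, which is a numerical comparison of
-- truncations near the star and follows from 2-periodicity far from it. A finite window of B around
-- k bounds λ_k(B) from below, since the unknown tails of a sequence in {1, 2, 3}^ℤ have continued
-- fractions in [5/4, 4]; so no window of B may push this bound above θ ≥ λ_0(J). A forcing tree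
-- extends 22221 w* 11122 letter by letter, and each branch either dies in this way, reaches
-- 2221 w w* w 11122, or reaches the window 2221 w w* w 11121 of J itself. In the last case B agrees
-- with J or deviates from it favourably at every position (a checked search on the left, the
-- 2-periodic tail 1212… on both far sides), so λ_0(B) ≥ λ_0(J), which is impossible.
module Submission where

open import Defs
open import Data.Nat using (ℕ; zero; suc; _+_; _*_; _∸_; _%_; _≤_; _<_; _>_; _≤?_; _<?_; z≤n; s≤s; _≟_)
open import Data.Nat.Properties
  using ( ≤-refl; ≤-trans; ≤-total; <-asym; ≤⇒≯; <-cmp; m≤m+n; m≤n⇒∃[o]m+o≡n; +-comm; *-suc
        ; *-zeroʳ; *-identityˡ; *-identityʳ; +-mono-≤; +-monoˡ-≤; +-monoʳ-≤
        ; *-mono-≤; *-monoˡ-≤; *-monoʳ-≤; *-monoˡ-<; *-cancelʳ-≤; *-cancelʳ-<; allUpTo?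
        ; module ≤-Reasoning )
open import Data.Nat.GeneralisedArithmetic using (iterate)
open import Data.Nat.Tactic.RingSolver using (solve-∀)
open import Data.Integer as ℤ using (ℤ; +_; -[1+_])
import Data.Integer.Properties as ℤ
open import Data.Bool as Bool using (Bool; true; false; not)
open import Data.Bool.Properties using (not-involutive)
open import Data.Fin using (toℕ) renaming (zero to fzero; suc to fsuc)
open import Data.List using (List; []; _∷_; _++_; [_]; length; lookup; map; upTo; applyUpTo; take)
open import Data.List.Properties using (map-cong; map-upTo; ∷-injective; ≡-dec)
open import Data.List.Relation.Unary.All as All using (All; []; _∷_; all?)
open import Data.Product using (_×_; _,_; proj₁; proj₂; ∃-syntax; swap)
open import Data.Sum using (_⊎_; inj₁; inj₂; [_,_]′)
open import Data.Empty using (⊥; ⊥-elim)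
open import Data.Unit using (⊤; tt)
open import Function using (_∘_)
open import Relation.Binary using (Tri; tri<; tri≈; tri>)
open import Relation.Nullary using (¬_; Dec; yes; no)
open import Relation.Nullary.Decidable using (toWitness; _×-dec_; _⊎-dec_)
open import Relation.Binary.PropositionalEquality hiding (J; [_])

Frac : Set
Frac = ℕ × ℕ

∞ : Frac
∞ = 1 , 0

≤q-refl : ∀ x → x ≤q x
≤q-refl _ = ≤-refl

x≤q∞ : ∀ x → x ≤q ∞
x≤q∞ (p , q) = subst (_≤ 1 * q) (sym (*-zeroʳ p)) z≤n

private
  *-swapʳ : ∀ a b c → a * b * c ≡ a * c * b
  *-swapʳ = solve-∀

≤q-trans : ∀ x y z → 1 ≤ proj₂ y → x ≤q y → y ≤q z → x ≤q z
≤q-trans (a , b) (c , d@(suc _)) (e , f) _ x≤y y≤z = *-cancelʳ-≤ (a * f) (e * b) d (begin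
  a * f * d ≡⟨ *-swapʳ a f d ⟩
  a * d * f ≤⟨ *-monoˡ-≤ f x≤y ⟩
  c * b * f ≡⟨ *-swapʳ c b f ⟩
  c * f * b ≤⟨ *-monoˡ-≤ b y≤z ⟩
  e * d * b ≡⟨ *-swapʳ e d b ⟩
  e * b * d ∎)
  where open ≤-Reasoning

<q-≤q-trans : ∀ x y z → 1 ≤ proj₂ z → x <q y → y ≤q z → x <q z
<q-≤q-trans (a , b) (c , d) (e , f@(suc _)) _ x<y y≤z = *-cancelʳ-< d (a * f) (e * b) (begin-strict
  a * f * d ≡⟨ *-swapʳ a f d ⟩
  a * d * f <⟨ *-monoˡ-< f x<y ⟩
  c * b * f ≡⟨ *-swapʳ c b f ⟩
  c * f * b ≤⟨ *-monoˡ-≤ b y≤z ⟩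
  e * d * b ≡⟨ *-swapʳ e d b ⟩
  e * b * d ∎)
  where open ≤-Reasoning

≤q-<q-trans : ∀ x y z → 1 ≤ proj₂ x → x ≤q y → y <q z → x <q z
≤q-<q-trans (a , b@(suc _)) (c , d) (e , f) _ x≤y y<z = *-cancelʳ-< d (a * f) (e * b) (begin-strict
  a * f * d ≡⟨ *-swapʳ a f d ⟩
  a * d * f ≤⟨ *-monoˡ-≤ f x≤y ⟩
  c * b * f ≡⟨ *-swapʳ c b f ⟩
  c * f * b <⟨ *-monoˡ-< b y<z ⟩
  e * d * b ≡⟨ *-swapʳ e d b ⟩
  e * b * d ∎)
  where open ≤-Reasoning

<q-asym : ∀ x y → x <q y → ¬ (y <q x)
<q-asym (a , b) (c , d) x<y y<x = <-asym x<y y<x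

≤q⇒≯q : ∀ x y → x ≤q y → ¬ (y <q x)
≤q⇒≯q (a , b) (c , d) x≤y y<x = ≤⇒≯ x≤y y<x

_≤q?_ : ∀ x y → Dec (x ≤q y)
x ≤q? y = proj₁ x * proj₂ y ≤? proj₁ y * proj₂ x

_<q?_ : ∀ x y → Dec (x <q y)
x <q? y = proj₁ x * proj₂ y <? proj₁ y * proj₂ x

-- Each step of a continued fraction reverses the order, which flips b.
_≤q[_]_ : Frac → Bool → Frac → Set
x ≤q[ true  ] y = x ≤q y
x ≤q[ false ] y = y ≤q x

≤q[]-refl : ∀ b x → x ≤q[ b ] x
≤q[]-refl true  x = ≤q-refl x
≤q[]-refl false x = ≤q-refl x

flips : ℕ → Bool → Bool
flips zero    b = b
flips (suc n) b = not (flips n b)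

flips-not : ∀ n b → flips n (not b) ≡ not (flips n b)
flips-not zero    b = refl
flips-not (suc n) b = cong not (flips-not n b)

flips-even : ∀ n b → flips (2 * n) b ≡ b
flips-even zero    b = refl
flips-even (suc n) b = trans (cong (λ m → flips m b) (*-suc 2 n)) (trans (not-involutive _) (flips-even n b))

infixl 25 _+1/_

_+1/_ : Frac → Frac → Frac
(a , b) +1/ (c , d) = a * c + b * d , b * c

+1/-mono : ∀ x x′ y y′ → x ≤q x′ → y′ ≤q y → x +1/ y ≤q x′ +1/ y′
+1/-mono (a , b) (a′ , b′) (c , d) (c′ , d′) a/b≤ c′/d′≤ = begin
  (a * c + b * d) * (b′ * c′)               ≡⟨ lhs a b c d b′ c′ ⟩
  a * b′ * (c * c′) + b * b′ * (c′ * d)     ≤⟨ +-mono-≤ (*-monoˡ-≤ (c * c′) a/b≤)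
                                                        (*-monoʳ-≤ (b * b′) c′/d′≤) ⟩
  a′ * b * (c * c′) + b * b′ * (c * d′)     ≡⟨ rhs a′ b c d′ b′ c′ ⟩
  (a′ * c′ + b′ * d′) * (b * c)             ∎
  where
  open ≤-Reasoning
  lhs : ∀ a b c d b′ c′ → (a * c + b * d) * (b′ * c′) ≡ a * b′ * (c * c′) + b * b′ * (c′ * d)
  lhs = solve-∀
  rhs : ∀ a′ b c d′ b′ c′ →
        a′ * b * (c * c′) + b * b′ * (c * d′) ≡ (a′ * c′ + b′ * d′) * (b * c)
  rhs = solve-∀

step : ℕ → Frac → Frac
step a (p , q) = a * p + q , p

step-antitone : ∀ a x y → y ≤q x → step a x ≤q step a y
step-antitone a (p , q) (p′ , q′) q/p′≤ =
  subst₂ _≤_ (lhs a p q p′) (rhs a p p′ q′) (+-monoʳ-≤ (a * p * p′) q/p′≤)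
  where
  lhs : ∀ a p q p′ → a * p * p′ + p′ * q ≡ (a * p + q) * p′
  lhs = solve-∀
  rhs : ∀ a p p′ q′ → a * p * p′ + p * q′ ≡ (a * p′ + q′) * p
  rhs = solve-∀

step-flip : ∀ a b {x y} → x ≤q[ b ] y → step a x ≤q[ not b ] step a y
step-flip a true  x≤y = step-antitone a _ _ x≤y
step-flip a false y≤x = step-antitone a _ _ y≤x

step-unflip : ∀ a b {x y} → x ≤q[ not b ] y → step a x ≤q[ b ] step a y
step-unflip a true  y≤x = step-antitone a _ _ y≤x
step-unflip a false x≤y = step-antitone a _ _ x≤y

cfWith : List ℕ → Frac → Frac
cfWith []      t = t
cfWith (a ∷ u) t = step a (cfWith u t)

cf-++ : ∀ u v → cf (u ++ v) ≡ cfWith u (cf v)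
cf-++ []      v = refl
cf-++ (a ∷ u) v = cong (step a) (cf-++ u v)

cfWith-∞ : ∀ u → cfWith u ∞ ≡ cf u
cfWith-∞ []      = refl
cfWith-∞ (a ∷ u) = cong (step a) (cfWith-∞ u)

cfWith-mono : ∀ u b {x y} → x ≤q[ b ] y → cfWith u x ≤q[ flips (length u) b ] cfWith u y
cfWith-mono []      b x≤y = x≤y
cfWith-mono (a ∷ u) b x≤y = step-flip a (flips (length u) b) (cfWith-mono u b x≤y)

cf-++-≤q[] : ∀ u v → cf (u ++ v) ≤q[ flips (length u) true ] cf u
cf-++-≤q[] u v = subst₂ (λ x y → x ≤q[ flips (length u) true ] y) (sym (cf-++ u v)) (cfWith-∞ u)
  (cfWith-mono u true (x≤q∞ (cf v)))

cf-positive : ∀ u → All (1 ≤_) u → 1 ≤ proj₁ (cf u) × proj₂ (cf u) ≤ proj₁ (cf u)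
cf-positive []      []           = s≤s z≤n , z≤n
cf-positive (a ∷ u) (1≤a ∷ 1≤u) with cf u | cf-positive u 1≤u
... | p , q | 1≤p , _ = ≤-trans 1≤p p≤ap+q , p≤ap+q
  where
  p≤ap+q : p ≤ a * p + q
  p≤ap+q = ≤-trans (subst (_≤ a * p) (*-identityˡ p) (*-monoˡ-≤ p 1≤a)) (m≤m+n (a * p) q)

-- [a; u] ≤ a + 1 ≤ b ≤ [b; v] as soon as [u] ≥ 1.
cf-head-< : ∀ a b u v → a < b → proj₂ (cf u) ≤ proj₁ (cf u) → cf (a ∷ u) ≤q cf (b ∷ v)
cf-head-< a b u v a<b q≤p with cf u | cf v
... | p , q | p′ , q′ = begin
  (a * p + q) * p′  ≤⟨ *-monoˡ-≤ p′ (+-monoʳ-≤ (a * p) q≤p) ⟩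
  (a * p + p) * p′  ≡⟨ lemma a p p′ ⟩
  suc a * p′ * p    ≤⟨ *-monoˡ-≤ p (*-monoˡ-≤ p′ a<b) ⟩
  b * p′ * p        ≤⟨ *-monoˡ-≤ p (m≤m+n (b * p′) q′) ⟩
  (b * p′ + q′) * p ∎
  where
  open ≤-Reasoning
  lemma : ∀ a p p′ → (a * p + p) * p′ ≡ suc a * p′ * p
  lemma = solve-∀

Letter : ℕ → Set
Letter a = 1 ≤ a × a ≤ 3

letter? : ∀ a → Dec (Letter a)
letter? a = 1 ≤? a ×-dec a ≤? 3

letter-case : ∀ {a} {P : Set} → Letter a → (a ≡ 1 → P) → (a ≡ 2 → P) → (a ≡ 3 → P) → P
letter-case {1} _ one _   _     = one refl
letter-case {2} _ _   two _     = two refl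
letter-case {3} _ _   _   three = three refl
letter-case {suc (suc (suc (suc _)))} (_ , s≤s (s≤s (s≤s ())))

all-letters : ∀ {P : ℕ → Set} → P 1 × P 2 × P 3 → ∀ {a} → Letter a → P a
all-letters {P} (p₁ , p₂ , p₃) a-letter =
  letter-case a-letter (λ a≡1 → subst P (sym a≡1) p₁) (λ a≡2 → subst P (sym a≡2) p₂)
                       (λ a≡3 → subst P (sym a≡3) p₃)

tailMin tailMax : Frac
tailMin = 5 , 4
tailMax = 4 , 1

cf-≤4 : ∀ b u → All Letter (b ∷ u) → proj₁ (cf (b ∷ u)) ≤ 4 * proj₂ (cf (b ∷ u))
cf-≤4 b u ((_ , b≤3) ∷ letters) with cf u | cf-positive u (All.map proj₁ letters)
... | p , q | _ , q≤p = begin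
  b * p + q ≤⟨ +-mono-≤ (*-monoˡ-≤ p b≤3) q≤p ⟩
  3 * p + p ≡⟨ lemma p ⟩
  4 * p     ∎
  where
  open ≤-Reasoning
  lemma : ∀ p → 3 * p + p ≡ 4 * p
  lemma = solve-∀

step-range : ∀ a p q → Letter a → q ≤ p → p ≤ 4 * q →
             tailMin ≤q step a (p , q) × step a (p , q) ≤q tailMax
step-range a p q (1≤a , a≤3) q≤p p≤4q = lower , upper
  where
  open ≤-Reasoning
  lower : 5 * p ≤ (a * p + q) * 4
  lower = begin
    5 * p           ≡⟨ l₁ p ⟩
    4 * p + p       ≤⟨ +-monoʳ-≤ (4 * p) p≤4q ⟩
    4 * p + 4 * q   ≡⟨ l₂ p q ⟩
    (1 * p + q) * 4 ≤⟨ *-monoˡ-≤ 4 (+-monoˡ-≤ q (*-monoˡ-≤ p 1≤a)) ⟩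
    (a * p + q) * 4 ∎
    where
    l₁ : ∀ p → 5 * p ≡ 4 * p + p
    l₁ = solve-∀
    l₂ : ∀ p q → 4 * p + 4 * q ≡ (1 * p + q) * 4
    l₂ = solve-∀
  upper : (a * p + q) * 1 ≤ 4 * p
  upper = begin
    (a * p + q) * 1 ≡⟨ *-identityʳ _ ⟩
    a * p + q       ≤⟨ +-mono-≤ (*-monoˡ-≤ p a≤3) q≤p ⟩
    3 * p + p       ≡⟨ l p ⟩
    4 * p           ∎
    where
    l : ∀ p → 3 * p + p ≡ 4 * p
    l = solve-∀

-- [a; b, …] = a + 1/[b; …] with [b; …] ∈ [1, 4].
cf-tail-range : ∀ a b u → All Letter (a ∷ b ∷ u) →
                tailMin ≤q cf (a ∷ b ∷ u) × cf (a ∷ b ∷ u) ≤q tailMax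
cf-tail-range a b u (a-letter ∷ letters) =
  step-range a _ _ a-letter (proj₂ (cf-positive (b ∷ u) (All.map proj₁ letters))) (cf-≤4 b u letters)

extreme : Bool → Frac
extreme true  = tailMin
extreme false = tailMax

extreme-≤q[] : ∀ b t → tailMin ≤q t → t ≤q tailMax → extreme b ≤q[ b ] t
extreme-≤q[] true  t min≤t _     = min≤t
extreme-≤q[] false t _     t≤max = t≤max

cfWith-extreme : ∀ u b t → tailMin ≤q t → t ≤q tailMax →
                 cfWith u (extreme (flips (length u) b)) ≤q[ b ] cfWith u t
cfWith-extreme []      b t min≤t t≤max = extreme-≤q[] b t min≤t t≤max
cfWith-extreme (a ∷ u) b t min≤t t≤max = step-unflip a b
  (subst (λ b′ → cfWith u (extreme b′) ≤q[ not b ] cfWith u t) (flips-not (length u) b)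
    (cfWith-extreme u (not b) t min≤t t≤max))

walk : (ℤ → ℤ) → Seq → ℤ → ℕ → List ℕ
walk next S k zero    = []
walk next S k (suc m) = S k ∷ walk next S (next k) m

forward backward : Seq → ℤ → ℕ → List ℕ
forward  S = walk ℤ.suc S
backward S = walk ℤ.pred (S ∘ ℤ.pred)

length-walk : ∀ next S k m → length (walk next S k m) ≡ m
length-walk next S k zero    = refl
length-walk next S k (suc m) = cong suc (length-walk next S (next k) m)

walk-++ : ∀ next S k m e → walk next S k (m + e) ≡ walk next S k m ++ walk next S (iterate next k m) e
walk-++ next S k zero    e = refl
walk-++ next S k (suc m) e = cong (S k ∷_) (walk-++ next S (next k) m e)

walk-letters : ∀ next {S} → In123 S → ∀ k m → All Letter (walk next S k m)
walk-letters next S-letters k zero    = []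
walk-letters next S-letters k (suc m) = S-letters k ∷ walk-letters next S-letters (next k) m

map-upTo-walk : ∀ next S (pos : ℕ → ℤ) → (∀ i → pos (suc i) ≡ next (pos i)) →
                ∀ m → map (S ∘ pos) (upTo m) ≡ walk next S (pos 0) m
map-upTo-walk next S pos pos-suc m = trans (map-upTo (S ∘ pos) m) (applyUpTo-walk pos pos-suc m)
  where
  applyUpTo-walk : ∀ (pos : ℕ → ℤ) → (∀ i → pos (suc i) ≡ next (pos i)) →
                   ∀ m → applyUpTo (S ∘ pos) m ≡ walk next S (pos 0) m
  applyUpTo-walk pos pos-suc zero    = refl
  applyUpTo-walk pos pos-suc (suc m) = cong (S (pos 0) ∷_)
    (trans (applyUpTo-walk (pos ∘ suc) (pos-suc ∘ suc) m) (cong (λ k → walk next S k m) (pos-suc 0)))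

+-+suc : ∀ k i → k ℤ.+ + suc i ≡ ℤ.suc k ℤ.+ + i
+-+suc k i = begin
  k ℤ.+ (ℤ.1ℤ ℤ.+ + i) ≡⟨ ℤ.+-assoc k ℤ.1ℤ (+ i) ⟨
  k ℤ.+ ℤ.1ℤ ℤ.+ + i   ≡⟨ cong (ℤ._+ + i) (ℤ.+-comm k ℤ.1ℤ) ⟩
  ℤ.1ℤ ℤ.+ k ℤ.+ + i   ∎
  where open ≡-Reasoning

fwd≡forward : ∀ S k m → fwd S k m ≡ forward S k m
fwd≡forward S k m = trans
  (map-upTo-walk ℤ.suc S (λ i → k ℤ.+ + i) (λ i → trans (+-+suc k i) (ℤ.+-assoc ℤ.1ℤ k (+ i))) m)
  (cong (λ k′ → forward S k′ m) (ℤ.+-identityʳ k))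

bwd≡backward : ∀ S k m → bwd S k m ≡ backward S k m
bwd≡backward S k m = begin
  map (λ i → S (k ℤ.- + suc i)) (upTo m)     ≡⟨ map-cong (λ i → cong S (ℤ.minus-suc k i)) (upTo m) ⟩
  map (λ i → S (ℤ.pred (k ℤ.- + i))) (upTo m)
    ≡⟨ map-upTo-walk ℤ.pred (S ∘ ℤ.pred) (λ i → k ℤ.- + i) (ℤ.minus-suc k) m ⟩
  backward S (k ℤ.- + 0) m                   ≡⟨ cong (λ k′ → backward S k′ m) (ℤ.+-identityʳ k) ⟩
  backward S k m                             ∎
  where open ≡-Reasoning

Reads : (ℤ → ℤ) → Seq → ℤ → List ℕ → Set
Reads next S k []      = ⊤
Reads next S k (x ∷ u) = S k ≡ x × Reads next S (next k) u

ReadsForward ReadsBackward : Seq → ℤ → List ℕ → Set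
ReadsForward  S = Reads ℤ.suc S
ReadsBackward S = Reads ℤ.pred (S ∘ ℤ.pred)

Reads⇒walk : ∀ next S k u → Reads next S k u → walk next S k (length u) ≡ u
Reads⇒walk next S k []      _           = refl
Reads⇒walk next S k (x ∷ u) (Sk≡x , rest) = cong₂ _∷_ Sk≡x (Reads⇒walk next S (next k) u rest)

walk⇒Reads : ∀ next S k u → walk next S k (length u) ≡ u → Reads next S k u
walk⇒Reads next S k []      _  = tt
walk⇒Reads next S k (x ∷ u) eq =
  proj₁ (∷-injective eq) , walk⇒Reads next S (next k) u (proj₂ (∷-injective eq))

Reads-walk-++ : ∀ next S k u e → Reads next S k u →
                walk next S k (length u + e) ≡ u ++ walk next S (iterate next k (length u)) e
Reads-walk-++ next S k u e reads = trans (walk-++ next S k (length u) e)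
  (cong (_++ walk next S (iterate next k (length u)) e) (Reads⇒walk next S k u reads))

Reads-∷ʳ : ∀ next S k u {x} → Reads next S k u → S (iterate next k (length u)) ≡ x →
           Reads next S k (u ++ [ x ])
Reads-∷ʳ next S k []      _              Sk≡x = Sk≡x , tt
Reads-∷ʳ next S k (y ∷ u) (Sk≡y , reads) Sj≡x = Sk≡y , Reads-∷ʳ next S (next k) u reads Sj≡x

ReadsForward-∷ : ∀ S k u {x} → ReadsForward S k u → S (ℤ.pred k) ≡ x →
                 ReadsForward S (ℤ.pred k) (x ∷ u)
ReadsForward-∷ S k u reads Sk-1≡x =
  Sk-1≡x , subst (λ k′ → ReadsForward S k′ u) (sym (ℤ.suc-pred k)) reads

ReadsForward⇒lookup : ∀ S k u → ReadsForward S k u → ∀ i → S (k ℤ.+ + toℕ i) ≡ lookup u i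
ReadsForward⇒lookup S k (x ∷ u) (Sk≡x , _)     fzero    = trans (cong S (ℤ.+-identityʳ k)) Sk≡x
ReadsForward⇒lookup S k (x ∷ u) (_    , reads) (fsuc i) =
  trans (cong S (+-+suc k (toℕ i))) (ReadsForward⇒lookup S (ℤ.suc k) u reads i)

lookup⇒ReadsForward : ∀ S k u → (∀ i → S (k ℤ.+ + toℕ i) ≡ lookup u i) → ReadsForward S k u
lookup⇒ReadsForward S k []      _      = tt
lookup⇒ReadsForward S k (x ∷ u) entries = trans (cong S (sym (ℤ.+-identityʳ k))) (entries fzero) ,
  lookup⇒ReadsForward S (ℤ.suc k) u (λ i → trans (cong S (sym (+-+suc k (toℕ i)))) (entries (fsuc i)))

Matches⇒ReadsForward : ∀ S u s → Matches S u s → ReadsForward S (ℤ.- + s) u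
Matches⇒ReadsForward S u s matches = lookup⇒ReadsForward S (ℤ.- + s) u
  (λ i → trans (cong S (ℤ.+-comm (ℤ.- + s) (+ toℕ i))) (matches i))

ReadsForward⇒Matches : ∀ S u s → ReadsForward S (ℤ.- + s) u → Matches S u s
ReadsForward⇒Matches S u s reads i =
  trans (cong S (ℤ.+-comm (+ toℕ i) (ℤ.- + s))) (ReadsForward⇒lookup S (ℤ.- + s) u reads i)

lowerλ≡ : ∀ S k n → lowerλ S k n ≡ cf (forward S k (suc (2 * n))) +1/ cf (backward S k (2 + 2 * n))
lowerλ≡ S k n =
  cong₂ (λ u v → cf u +1/ cf v) (fwd≡forward S k (suc (2 * n))) (bwd≡backward S k (2 + 2 * n))

upperλ : Seq → ℤ → ℕ → Frac
upperλ S k m = cf (forward S k (2 + 2 * m)) +1/ cf (backward S k (suc (2 * m)))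

cf-walk-++ : ∀ next S k m e → cf (walk next S k (m + e)) ≤q[ flips m true ] cf (walk next S k m)
cf-walk-++ next S k m e rewrite walk-++ next S k m e =
  subst (λ l → cf (walk next S k m ++ rest) ≤q[ flips l true ] cf (walk next S k m))
        (length-walk next S k m) (cf-++-≤q[] (walk next S k m) rest)
  where rest = walk next S (iterate next k m) e

cf-walk-odd≤even : ∀ next S k i j → cf (walk next S k (suc (2 * i))) ≤q cf (walk next S k (2 + 2 * j))
cf-walk-odd≤even next S k i j with ≤-total (suc (2 * i)) (2 + 2 * j)
... | inj₁ odd≤even = let e , odd+e≡even = m≤n⇒∃[o]m+o≡n odd≤even in
  subst (λ n → cf (walk next S k (suc (2 * i))) ≤q cf (walk next S k n)) odd+e≡even
    (subst (λ b → cf (walk next S k (suc (2 * i) + e)) ≤q[ b ] cf (walk next S k (suc (2 * i))))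
           (cong not (flips-even i true)) (cf-walk-++ next S k (suc (2 * i)) e))
... | inj₂ even≤odd = let e , even+e≡odd = m≤n⇒∃[o]m+o≡n even≤odd in
  subst (λ n → cf (walk next S k n) ≤q cf (walk next S k (2 + 2 * j))) even+e≡odd
    (subst (λ b → cf (walk next S k (2 + 2 * j + e)) ≤q[ b ] cf (walk next S k (2 + 2 * j)))
           (trans (not-involutive _) (flips-even j true)) (cf-walk-++ next S k (2 + 2 * j) e))

lowerλ≤upperλ : ∀ S k n m → lowerλ S k n ≤q upperλ S k m
lowerλ≤upperλ S k n m = subst (_≤q upperλ S k m) (sym (lowerλ≡ S k n))
  (+1/-mono (cf (forward S k (suc (2 * n)))) (cf (forward S k (2 + 2 * m)))
            (cf (backward S k (2 + 2 * n))) (cf (backward S k (suc (2 * m))))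
            (cf-walk-odd≤even ℤ.suc S k n m) (cf-walk-odd≤even ℤ.pred (S ∘ ℤ.pred) k m n))

+1/-denominator : ∀ a u v → All (1 ≤_) u → All (1 ≤_) v → 1 ≤ proj₂ (cf (a ∷ u) +1/ cf v)
+1/-denominator a u v u-positive v-positive =
  *-mono-≤ (proj₁ (cf-positive u u-positive)) (proj₁ (cf-positive v v-positive))

walk-positive : ∀ next {S} → In123 S → ∀ k m → All (1 ≤_) (walk next S k m)
walk-positive next S-letters k m = All.map proj₁ (walk-letters next S-letters k m)

lowerλ-denominator : ∀ {S} → In123 S → ∀ k n → 1 ≤ proj₂ (lowerλ S k n)
lowerλ-denominator {S} S-letters k n = subst (λ x → 1 ≤ proj₂ x) (sym (lowerλ≡ S k n))
  (+1/-denominator (S k) (forward S (ℤ.suc k) (2 * n)) (backward S k (2 + 2 * n))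
    (walk-positive ℤ.suc S-letters (ℤ.suc k) (2 * n))
    (walk-positive ℤ.pred (S-letters ∘ ℤ.pred) k (2 + 2 * n)))

upperλ-denominator : ∀ {S} → In123 S → ∀ k m → 1 ≤ proj₂ (upperλ S k m)
upperλ-denominator {S} S-letters k m =
  +1/-denominator (S k) (forward S (ℤ.suc k) (suc (2 * m))) (backward S k (suc (2 * m)))
    (walk-positive ℤ.suc S-letters (ℤ.suc k) (suc (2 * m)))
    (walk-positive ℤ.pred (S-letters ∘ ℤ.pred) k (suc (2 * m)))

lowerλ≤-via-upperλ : ∀ {S} → In123 S → ∀ k n m x → upperλ S k m ≤q x → lowerλ S k n ≤q x
lowerλ≤-via-upperλ {S} S-letters k n m x = ≤q-trans (lowerλ S k n) (upperλ S k m) x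
  (upperλ-denominator S-letters k m) (lowerλ≤upperλ S k n m)

-- A centre together with the letters read leftwards and rightwards from it.
data Window : Set where
  window : ℤ → List ℕ → List ℕ → Window

centre : Window → ℤ
centre (window k _ _) = k

Around : Seq → Window → Set
Around S (window k Q P) = ReadsBackward S k Q × ReadsForward S k P

recentre : ℕ → Window → Window
recentre zero    w                     = w
recentre (suc i) (window k Q [])       = window k Q []
recentre (suc i) (window k Q (x ∷ P)) = recentre i (window (ℤ.suc k) (x ∷ Q) P)

Around-recentre : ∀ S i w → Around S w → Around S (recentre i w)
Around-recentre S zero    w                     around = around
Around-recentre S (suc i) (window k Q [])       around = around
Around-recentre S (suc i) (window k Q (x ∷ P)) (readsQ , Sk≡x , readsP) = Around-recentre S i _
  (subst (λ j → S j ≡ x × ReadsBackward S j Q) (sym (ℤ.pred-suc k)) (Sk≡x , readsQ) , readsP)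

-- A lower bound for λ at the centre of every sequence in {1, 2, 3}^ℤ around which the window is read:
-- the unknown tails are replaced by the extreme values in [5/4, 4].
windowλ : Window → Frac
windowλ (window _ Q P) = cfWith P (extreme (flips (length P) true)) +1/ cfWith Q (extreme (flips (length Q) false))

cfWith-extreme-walk : ∀ next S → In123 S → ∀ k u b e → Reads next S k u →
                      cfWith u (extreme (flips (length u) b)) ≤q[ b ] cf (walk next S k (length u + (2 + e)))
cfWith-extreme-walk next S S-letters k u b e reads =
  subst (λ v → cfWith u (extreme (flips (length u) b)) ≤q[ b ] cf v)
        (sym (Reads-walk-++ next S k u (2 + e) reads))
    (subst (cfWith u (extreme (flips (length u) b)) ≤q[ b ]_) (sym (cf-++ u tail))
      (cfWith-extreme u b (cf tail) (proj₁ tail-range) (proj₂ tail-range)))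
  where
  k′ = iterate next k (length u)
  tail = walk next S k′ (2 + e)
  tail-range = cf-tail-range (S k′) (S (next k′)) (walk next S (next (next k′)) e)
                             (walk-letters next S-letters k′ (2 + e))

windowλ≤lowerλ : ∀ {S} → In123 S → ∀ w → Around S w → ∃[ n ] windowλ w ≤q lowerλ S (centre w) n
windowλ≤lowerλ {S} S-letters (window k Q P) (readsQ , readsP) = n ,
  subst (windowλ (window k Q P) ≤q_) (sym (lowerλ≡ S k n))
    (+1/-mono lowP (cf (forward S k (suc (2 * n)))) highQ (cf (backward S k (2 + 2 * n)))
              forward-bound backward-bound)
  where
  n = length P + length Q + 1
  lowP = cfWith P (extreme (flips (length P) true))
  highQ = cfWith Q (extreme (flips (length Q) false))
  forward-length : ∀ p q → p + (2 + (p + 2 * q + 1)) ≡ suc (2 * (p + q + 1))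
  forward-length = solve-∀
  backward-length : ∀ p q → q + (2 + (2 * p + q + 2)) ≡ 2 + 2 * (p + q + 1)
  backward-length = solve-∀
  forward-bound : lowP ≤q cf (forward S k (suc (2 * n)))
  forward-bound = subst (λ m → lowP ≤q cf (forward S k m)) (forward-length (length P) (length Q))
    (cfWith-extreme-walk ℤ.suc S S-letters k P true _ readsP)
  backward-bound : cf (backward S k (2 + 2 * n)) ≤q highQ
  backward-bound = subst (λ m → cf (backward S k m) ≤q highQ) (backward-length (length P) (length Q))
    (cfWith-extreme-walk ℤ.pred (S ∘ ℤ.pred) (S-letters ∘ ℤ.pred) k Q false _ readsQ)

BelowAt : (ℤ → ℤ) → Bool → Seq → Seq → ℤ → ℕ → Set
BelowAt next b S T k L = cf (walk next S k L) ≤q[ b ] cf (walk next T k L)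

belowAt-zero : ∀ next b S T k → BelowAt next b S T k 0
belowAt-zero next b S T k = ≤q[]-refl b ∞

belowAt-agree : ∀ next b S T k L → S k ≡ T k → BelowAt next (not b) S T (next k) L →
                BelowAt next b S T k (suc L)
belowAt-agree next b S T k L Sk≡Tk below =
  subst (λ a → step a (cf (walk next S (next k) L)) ≤q[ b ] step (T k) (cf (walk next T (next k) L)))
        (sym Sk≡Tk) (step-unflip (T k) b below)

belowAt-< : ∀ next S T k L → In123 S → S k < T k → BelowAt next true S T k L
belowAt-< next S T k zero    S-letters Sk<Tk = ≤q-refl ∞
belowAt-< next S T k (suc L) S-letters Sk<Tk = cf-head-< (S k) (T k) (walk next S (next k) L) (walk next T (next k) L)
  Sk<Tk (proj₂ (cf-positive (walk next S (next k) L) (walk-positive next S-letters (next k) L)))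

belowAt-agree-on : ∀ next b S T k u → Reads next S k u → Reads next T k u →
                   (∀ L → BelowAt next (flips (length u) b) S T (iterate next k (length u)) L) →
                   ∀ L → BelowAt next b S T k L
belowAt-agree-on next b S T k []      _                 _                 below L       = below L
belowAt-agree-on next b S T k (x ∷ u) _                 _                 below zero    = belowAt-zero next b S T k
belowAt-agree-on next b S T k (x ∷ u) (Sk≡x , S-reads) (Tk≡x , T-reads) below (suc L) =
  belowAt-agree next b S T k L (trans Sk≡x (sym Tk≡x))
    (belowAt-agree-on next (not b) S T (next k) u S-reads T-reads below′ L)
  where
  below′ : ∀ L → BelowAt next (flips (length u) (not b)) S T (iterate next (next k) (length u)) L
  below′ L = subst (λ b′ → BelowAt next b′ S T (iterate next (next k) (length u)) L)
                   (sym (flips-not (length u) b)) (below L)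

lowerλ-mono : ∀ S T k n → (∀ L → BelowAt ℤ.suc true S T k L) →
              (∀ L → BelowAt ℤ.pred true (T ∘ ℤ.pred) (S ∘ ℤ.pred) k L) →
              lowerλ S k n ≤q lowerλ T k n
lowerλ-mono S T k n forward-below backward-below = subst₂ _≤q_ (sym (lowerλ≡ S k n)) (sym (lowerλ≡ T k n))
  (+1/-mono (cf (forward S k (suc (2 * n)))) (cf (forward T k (suc (2 * n))))
            (cf (backward S k (2 + 2 * n))) (cf (backward T k (2 + 2 * n)))
            (forward-below (suc (2 * n))) (backward-below (2 + 2 * n)))

1<2 : 1 < 2
1<2 = s≤s (s≤s z≤n)

1<3 : 1 < 3
1<3 = s≤s (s≤s z≤n)

tail12 : ℕ → ℕ
tail12 zero          = 1
tail12 (suc zero)    = 2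
tail12 (suc (suc n)) = tail12 n

-- Where S continues as 1, 2, 1, 2, … along the walk and T has just read 1 2, T either copies S or
-- leaves it on the favourable side, because the pattern 1 2 1 3 is excluded in T.
module PeriodicTail (next : ℤ → ℤ) (S T : Seq) (pos : ℕ → ℤ)
                    (pos-suc : ∀ n → next (pos n) ≡ pos (suc n))
                    (S-letters : In123 S) (T-letters : In123 T)
                    (S-tail : ∀ j → S (pos (2 + j)) ≡ tail12 j)
                    (no-1213 : ∀ j → T (pos j) ≡ 1 → T (pos (1 + j)) ≡ 2 → T (pos (2 + j)) ≡ 1 →
                                     T (pos (3 + j)) ≡ 3 → ⊥)
                    where

  tail12-suc-1 : ∀ j → tail12 j ≡ 1 → tail12 (suc j) ≡ 2
  tail12-suc-1 zero          _    = refl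
  tail12-suc-1 (suc (suc j)) t≡1 = tail12-suc-1 j t≡1

  tail12-suc-2 : ∀ j → tail12 (suc j) ≡ 2 → tail12 j ≡ 1
  tail12-suc-2 zero          _    = refl
  tail12-suc-2 (suc (suc j)) t≡2 = tail12-suc-2 j t≡2

  next-pos : ∀ b n L → BelowAt next b S T (pos (suc n)) L → BelowAt next b S T (next (pos n)) L
  next-pos b n L = subst (λ k → BelowAt next b S T k L) (sym (pos-suc n))

  mutual
    after-12 : ∀ j L → tail12 j ≡ 1 → T (pos j) ≡ 1 → T (pos (1 + j)) ≡ 2 →
               BelowAt next true S T (pos (2 + j)) L
    after-12 j zero    _    _  _  = belowAt-zero next true S T (pos (2 + j))
    after-12 j (suc L) t≡1 T₀ T₁ = letter-case (T-letters (pos (2 + j)))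
      (λ T₂≡1 → belowAt-agree next true S T (pos (2 + j)) L (trans S₂≡1 (sym T₂≡1))
                  (next-pos false (2 + j) L (after-121 j L (tail12-suc-1 j t≡1) T₀ T₁ T₂≡1)))
      (λ T₂≡2 → belowAt-< next S T (pos (2 + j)) (suc L) S-letters
                  (subst₂ _<_ (sym S₂≡1) (sym T₂≡2) 1<2))
      (λ T₂≡3 → belowAt-< next S T (pos (2 + j)) (suc L) S-letters
                  (subst₂ _<_ (sym S₂≡1) (sym T₂≡3) 1<3))
      where
      S₂≡1 = trans (S-tail j) t≡1

    after-121 : ∀ j L → tail12 (suc j) ≡ 2 → T (pos j) ≡ 1 → T (pos (1 + j)) ≡ 2 →
                T (pos (2 + j)) ≡ 1 → BelowAt next false S T (pos (3 + j)) L
    after-121 j zero    _    _  _  _  = belowAt-zero next false S T (pos (3 + j))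
    after-121 j (suc L) t≡2 T₀ T₁ T₂ = letter-case (T-letters (pos (3 + j)))
      (λ T₃≡1 → belowAt-< next T S (pos (3 + j)) (suc L) T-letters
                  (subst₂ _<_ (sym T₃≡1) (sym S₃≡2) 1<2))
      (λ T₃≡2 → belowAt-agree next false S T (pos (3 + j)) L (trans S₃≡2 (sym T₃≡2))
                  (next-pos true (3 + j) L (after-12 (2 + j) L (tail12-suc-2 j t≡2) T₂ T₃≡2)))
      (λ T₃≡3 → ⊥-elim (no-1213 j T₀ T₁ T₂ T₃≡3))
      where
      S₃≡2 = trans (S-tail (suc j)) t≡2


nthOr-All : ∀ {P : ℕ → Set} {d} l n → All P l → n < length l → P (nthOr d l n)
nthOr-All (x ∷ l) zero    (Px ∷ _)   _         = Px
nthOr-All (x ∷ l) (suc n) (_ ∷ Pl) (s≤s n<l) = nthOr-All l n Pl n<l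

letter-1 : Letter 1
letter-1 = s≤s z≤n , s≤s z≤n

letter-2 : Letter 2
letter-2 = s≤s z≤n , s≤s (s≤s z≤n)

Jpos-letter : ∀ z → Letter (Jpos z)
Jpos-letter -[1+ n ] with n % 2
... | zero  = letter-1
... | suc _ = letter-2
Jpos-letter (+ n) with n <? length M
... | yes n<|M| = nthOr-All M n (toWitness {a? = all? letter? M} tt) n<|M|
... | no _ with (n ∸ length M) % 2
...   | zero  = letter-1
...   | suc _ = letter-2

J-letters : In123 J
J-letters i = Jpos-letter (i ℤ.+ + 43)

Jpos-right : ∀ m → Jpos (+ (65 + m)) ≡ tail12 m
Jpos-right zero          = refl
Jpos-right (suc zero)    = refl
Jpos-right (suc (suc m)) = Jpos-right m

J-right : ∀ m → J (+ (22 + m)) ≡ tail12 m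
J-right m = trans (cong (λ t → Jpos (+ (22 + t))) (+-comm m 43)) (Jpos-right m)

J-left : ∀ m → J (-[1+ (45 + m) ]) ≡ tail12 m
J-left zero          = refl
J-left (suc zero)    = refl
J-left (suc (suc m)) = J-left m

periodicUpper : ℕ → ℕ → Frac
periodicUpper x y = cf (x ∷ y ∷ x ∷ y ∷ []) +1/ cf (y ∷ x ∷ y ∷ [])

J-upperλ-right : ∀ j → upperλ J (+ (25 + j)) 1 ≡ periodicUpper (tail12 (suc j)) (tail12 j)
J-upperλ-right j = cong₂ (λ u v → cf u +1/ cf v)
  (Reads⇒walk ℤ.suc J (+ (25 + j)) (_ ∷ _ ∷ _ ∷ _ ∷ [])
    (J-right (3 + j) , J-right (4 + j) , J-right (5 + j) , J-right (6 + j) , tt))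
  (Reads⇒walk ℤ.pred (J ∘ ℤ.pred) (+ (25 + j)) (_ ∷ _ ∷ _ ∷ [])
    (J-right (2 + j) , J-right (1 + j) , J-right j , tt))

J-upperλ-left : ∀ j → upperλ J (-[1+ (61 + j) ]) 1 ≡ periodicUpper (tail12 j) (tail12 (suc j))
J-upperλ-left j = cong₂ (λ u v → cf u +1/ cf v)
  (Reads⇒walk ℤ.suc J (-[1+ (61 + j) ]) (_ ∷ _ ∷ _ ∷ _ ∷ [])
    (J-left (16 + j) , J-left (15 + j) , J-left (14 + j) , J-left (13 + j) , tt))
  (Reads⇒walk ℤ.pred (J ∘ ℤ.pred) (-[1+ (61 + j) ]) (_ ∷ _ ∷ _ ∷ [])
    (J-left (17 + j) , J-left (18 + j) , J-left (19 + j) , tt))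

-- λ⁻ ≤ λ_0(J) = m(J) ≤ θ, both ≈ 3.83407317. They are opaque: a conversion problem unfolding them
-- next to a symbolic fraction would evaluate products with 21-digit numbers in unary.
opaque
  λ⁻ θ : Frac
  λ⁻ = lowerλ J (+ 0) 16
  θ  = upperλ J (+ 0) 16

Exceeds : ℤ → List ℕ → List ℕ → Set
Exceeds k Q []      = θ <q windowλ (window k Q [])
Exceeds k Q (x ∷ P) = θ <q windowλ (window k Q (x ∷ P)) ⊎ Exceeds (ℤ.suc k) (x ∷ Q) P

exceeds? : ∀ k Q P → Dec (Exceeds k Q P)
exceeds? k Q []      = θ <q? windowλ (window k Q [])
exceeds? k Q (x ∷ P) = θ <q? windowλ (window k Q (x ∷ P)) ⊎-dec exceeds? (ℤ.suc k) (x ∷ Q) P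

-- The window of J at positions −20 … 21; it differs from concWord only in its last letter.
jWin : List ℕ
jWin = 2 ∷ 2 ∷ 2 ∷ 1 ∷ w ++ w ++ w ++ 1 ∷ 1 ∷ 1 ∷ 2 ∷ 1 ∷ []

J-reads-jWin : ReadsForward J (-[1+ 19 ]) jWin
J-reads-jWin = walk⇒Reads ℤ.suc J (-[1+ 19 ]) jWin refl

data Forcing : Set where
  conclusion jWindow : Forcing
  exceeds            : ℕ → Forcing
  right left         : Forcing → Forcing → Forcing → Forcing

-- A valid tree shows that a sequence reading W rightwards from lo reads concWord or jWin from −20:
-- right and left branch on the next letter, and exceeds i refutes the window centred i letters into W.
Valid : ℤ → List ℕ → Forcing → Set
Valid lo W conclusion       = lo ≡ -[1+ 19 ] × W ≡ concWord
Valid lo W jWindow          = lo ≡ -[1+ 19 ] × W ≡ jWin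
Valid lo W (exceeds i)      = θ <q windowλ (recentre i (window lo [] W))
Valid lo W (right t₁ t₂ t₃) =
  Valid lo (W ++ [ 1 ]) t₁ × Valid lo (W ++ [ 2 ]) t₂ × Valid lo (W ++ [ 3 ]) t₃
Valid lo W (left t₁ t₂ t₃)  =
  Valid (ℤ.pred lo) (1 ∷ W) t₁ × Valid (ℤ.pred lo) (2 ∷ W) t₂ × Valid (ℤ.pred lo) (3 ∷ W) t₃

valid? : ∀ lo W t → Dec (Valid lo W t)
valid? lo W conclusion       = lo ℤ.≟ -[1+ 19 ] ×-dec ≡-dec _≟_ W concWord
valid? lo W jWindow          = lo ℤ.≟ -[1+ 19 ] ×-dec ≡-dec _≟_ W jWin
valid? lo W (exceeds i)      = θ <q? windowλ (recentre i (window lo [] W))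
valid? lo W (right t₁ t₂ t₃) =
  valid? lo (W ++ [ 1 ]) t₁ ×-dec valid? lo (W ++ [ 2 ]) t₂ ×-dec valid? lo (W ++ [ 3 ]) t₃
valid? lo W (left t₁ t₂ t₃)  =
  valid? (ℤ.pred lo) (1 ∷ W) t₁ ×-dec valid? (ℤ.pred lo) (2 ∷ W) t₂
                                ×-dec valid? (ℤ.pred lo) (3 ∷ W) t₃

forcing : Forcing
forcing =
  (right (exceeds 10) (exceeds 10) (left (exceeds 11) (exceeds 11) (right (exceeds 22) (left (exceeds 1)
  (right (left (exceeds 13) (exceeds 13) (exceeds 2)) (left (exceeds 13) (right (exceeds 24) (left (right
  (left (exceeds 15) (exceeds 4) (exceeds 0)) (left (right (left (right (left (right (left (exceeds 7)
  (right (left (exceeds 19) (right (exceeds 30) (left (exceeds 9) (right jWindow conclusion (exceeds 31))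
  (exceeds 20)) (exceeds 39)) (exceeds 8)) (exceeds 29) (exceeds 29)) (exceeds 0)) (left (exceeds 7)
  (right (exceeds 18) (left (exceeds 19) (exceeds 19) (exceeds 8)) (left (exceeds 19) (exceeds 19)
  (exceeds 8))) (exceeds 0)) (exceeds 35)) (exceeds 6) (exceeds 0)) (exceeds 27) (exceeds 27))
  (exceeds 16) (exceeds 0)) (left (right (left (right (left (exceeds 7) (exceeds 18) (exceeds 0)) (left
  (exceeds 7) (exceeds 18) (exceeds 0)) (exceeds 35)) (exceeds 6) (exceeds 0)) (left (right (left
  (exceeds 7) (exceeds 18) (exceeds 0)) (left (exceeds 7) (exceeds 18) (exceeds 0)) (left (exceeds 7)
  (exceeds 18) (exceeds 0))) (exceeds 6) (exceeds 0)) (left (right (exceeds 34) (left (exceeds 7)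
  (exceeds 18) (exceeds 0)) (left (exceeds 7) (exceeds 18) (exceeds 0))) (exceeds 6) (exceeds 0)))
  (exceeds 16) (exceeds 0)) (left (right (exceeds 32) (left (exceeds 17) (exceeds 6) (exceeds 0)) (left
  (exceeds 17) (exceeds 6) (exceeds 0))) (exceeds 16) (exceeds 0))) (exceeds 4) (exceeds 0)) (exceeds 25))
  (exceeds 14) (exceeds 14)) (left (right (exceeds 28) (left (exceeds 15) (exceeds 4) (exceeds 0)) (left
  (exceeds 15) (exceeds 4) (exceeds 0))) (exceeds 14) (exceeds 14))) (exceeds 2)) (exceeds 23))
  (exceeds 12)) (left (exceeds 1) (exceeds 12) (exceeds 12)))))

mutual
  -- Certifies, for B reading W rightwards from lo, that the backward walks of B from lo stay b-below
  -- those of J: each letter agrees with J, deviates favourably, or yields a window exceeding θ. When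
  -- the fuel runs out J continues as …1212 and B has just read 1 2 leftwards.
  LeftCertificate : ℕ → ℤ → List ℕ → Bool → Set
  LeftCertificate zero    lo W b = lo ≡ -[1+ 44 ] × b ≡ false × take 2 W ≡ 2 ∷ 1 ∷ []
  LeftCertificate (suc f) lo W b = Deviation f lo W b 1 (<-cmp 1 (J (ℤ.pred lo)))
                                 × Deviation f lo W b 2 (<-cmp 2 (J (ℤ.pred lo)))
                                 × Deviation f lo W b 3 (<-cmp 3 (J (ℤ.pred lo)))

  Deviation : ℕ → (lo : ℤ) → List ℕ → Bool → (x : ℕ) →
              Tri (x < J (ℤ.pred lo)) (x ≡ J (ℤ.pred lo)) (x > J (ℤ.pred lo)) → Set
  Deviation f lo W b     x (tri≈ _ _ _) = LeftCertificate f (ℤ.pred lo) (x ∷ W) (not b)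
  Deviation f lo W true  x (tri< _ _ _) = ⊤
  Deviation f lo W false x (tri> _ _ _) = ⊤
  Deviation f lo W true  x (tri> _ _ _) = Exceeds (ℤ.pred lo) [] (x ∷ W)
  Deviation f lo W false x (tri< _ _ _) = Exceeds (ℤ.pred lo) [] (x ∷ W)

mutual
  leftCertificate? : ∀ f lo W b → Dec (LeftCertificate f lo W b)
  leftCertificate? zero    lo W b =
    lo ℤ.≟ -[1+ 44 ] ×-dec b Bool.≟ false ×-dec ≡-dec _≟_ (take 2 W) (2 ∷ 1 ∷ [])
  leftCertificate? (suc f) lo W b = deviation? f lo W b 1 (<-cmp 1 (J (ℤ.pred lo)))
                                 ×-dec deviation? f lo W b 2 (<-cmp 2 (J (ℤ.pred lo)))
                                 ×-dec deviation? f lo W b 3 (<-cmp 3 (J (ℤ.pred lo)))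

  deviation? : ∀ f lo W b x c → Dec (Deviation f lo W b x c)
  deviation? f lo W b     x (tri≈ _ _ _) = leftCertificate? f (ℤ.pred lo) (x ∷ W) (not b)
  deviation? f lo W true  x (tri< _ _ _) = yes tt
  deviation? f lo W false x (tri> _ _ _) = yes tt
  deviation? f lo W true  x (tri> _ _ _) = exceeds? (ℤ.pred lo) [] (x ∷ W)
  deviation? f lo W false x (tri< _ _ _) = exceeds? (ℤ.pred lo) [] (x ∷ W)

opaque
  unfolding λ⁻ θ

  λ⁻-lowerλ : λ⁻ ≡ lowerλ J (+ 0) 16
  λ⁻-lowerλ = refl

  θ-upperλ : θ ≡ upperλ J (+ 0) 16
  θ-upperλ = refl

  periodicUpper-12 : periodicUpper 1 2 ≤q λ⁻ × periodicUpper 2 1 ≤q λ⁻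
  periodicUpper-12 = toWitness {a? = periodicUpper 1 2 ≤q? λ⁻ ×-dec periodicUpper 2 1 ≤q? λ⁻} tt

  J-upperλ-near-right : ∀ {m} → m < 24 → upperλ J (+ suc m) 16 ≤q λ⁻
  J-upperλ-near-right = toWitness {a? = allUpTo? (λ m → upperλ J (+ suc m) 16 ≤q? λ⁻) 24} tt

  J-upperλ-near-left : ∀ {a} → a < 61 → upperλ J -[1+ a ] 16 ≤q λ⁻
  J-upperλ-near-left = toWitness {a? = allUpTo? (λ a → upperλ J -[1+ a ] 16 ≤q? λ⁻) 61} tt

  forcing-valid : Valid (-[1+ 9 ]) hypWord forcing
  forcing-valid = toWitness {a? = valid? (-[1+ 9 ]) hypWord forcing} tt

  left-certificate : LeftCertificate 25 (-[1+ 19 ]) jWin true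
  left-certificate = toWitness {a? = leftCertificate? 25 (-[1+ 19 ]) jWin true} tt

  θ<121∣3 : ∀ k → θ <q windowλ (window k (1 ∷ 2 ∷ 1 ∷ []) (3 ∷ []))
  θ<121∣3 k = toWitness {a? = θ <q? windowλ (window k (1 ∷ 2 ∷ 1 ∷ []) (3 ∷ []))} tt

  θ<∣3121 : ∀ k → θ <q windowλ (window k [] (3 ∷ 1 ∷ 2 ∷ 1 ∷ []))
  θ<∣3121 k = toWitness {a? = θ <q? windowλ (window k [] (3 ∷ 1 ∷ 2 ∷ 1 ∷ []))} tt

  θ<jWin13 : ∀ {x} → Letter x →
             θ <q windowλ (recentre 43 (window (-[1+ 19 ]) [] (jWin ++ 1 ∷ 3 ∷ x ∷ [])))
  θ<jWin13 = all-letters {P = Exceeding}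
    (toWitness {a? = exceeding? 1 ×-dec exceeding? 2 ×-dec exceeding? 3} tt)
    where
    Exceeding : ℕ → Set
    Exceeding x = θ <q windowλ (recentre 43 (window (-[1+ 19 ]) [] (jWin ++ 1 ∷ 3 ∷ x ∷ [])))
    exceeding? : ∀ x → Dec (Exceeding x)
    exceeding? x = θ <q? windowλ (recentre 43 (window (-[1+ 19 ]) [] (jWin ++ 1 ∷ 3 ∷ x ∷ [])))

periodicUpper-≤λ⁻ : ∀ j → periodicUpper (tail12 j) (tail12 (suc j)) ≤q λ⁻
                        × periodicUpper (tail12 (suc j)) (tail12 j) ≤q λ⁻
periodicUpper-≤λ⁻ zero          = periodicUpper-12
periodicUpper-≤λ⁻ (suc zero)    = swap periodicUpper-12
periodicUpper-≤λ⁻ (suc (suc j)) = periodicUpper-≤λ⁻ j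

below-or-beyond : ∀ b m → m < b ⊎ ∃[ j ] m ≡ b + j
below-or-beyond zero    m       = inj₂ (m , refl)
below-or-beyond (suc b) zero    = inj₁ (s≤s z≤n)
below-or-beyond (suc b) (suc m) with below-or-beyond b m
... | inj₁ m<b       = inj₁ (s≤s m<b)
... | inj₂ (j , m≡b+j) = inj₂ (j , cong suc m≡b+j)

J-upperλ-bound-right : ∀ m → ∃[ r ] upperλ J (+ suc m) r ≤q λ⁻
J-upperλ-bound-right m = [ (λ m<24 → 16 , J-upperλ-near-right m<24) , far ]′ (below-or-beyond 24 m)
  where
  far : ∃[ j ] m ≡ 24 + j → ∃[ r ] upperλ J (+ suc m) r ≤q λ⁻
  far (j , m≡24+j) = 1 , subst (λ m → upperλ J (+ suc m) 1 ≤q λ⁻) (sym m≡24+j)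
    (subst (_≤q λ⁻) (sym (J-upperλ-right j)) (proj₂ (periodicUpper-≤λ⁻ j)))

J-upperλ-bound-left : ∀ a → ∃[ r ] upperλ J -[1+ a ] r ≤q λ⁻
J-upperλ-bound-left a = [ (λ a<61 → 16 , J-upperλ-near-left a<61) , far ]′ (below-or-beyond 61 a)
  where
  far : ∃[ j ] a ≡ 61 + j → ∃[ r ] upperλ J -[1+ a ] r ≤q λ⁻
  far (j , a≡61+j) = 1 , subst (λ a → upperλ J -[1+ a ] 1 ≤q λ⁻) (sym a≡61+j)
    (subst (_≤q λ⁻) (sym (J-upperλ-left j)) (proj₁ (periodicUpper-≤λ⁻ j)))

J-λ-max : ∀ k n → ∃[ n′ ] lowerλ J k n ≤q lowerλ J (+ 0) n′
J-λ-max (+ zero)  n = n , ≤q-refl (lowerλ J (+ 0) n)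
J-λ-max (+ suc m) n = let r , bound = J-upperλ-bound-right m in
  16 , subst (lowerλ J (+ suc m) n ≤q_) λ⁻-lowerλ (lowerλ≤-via-upperλ J-letters (+ suc m) n r λ⁻ bound)
J-λ-max -[1+ a ]  n = let r , bound = J-upperλ-bound-left a in
  16 , subst (lowerλ J -[1+ a ] n ≤q_) λ⁻-lowerλ (lowerλ≤-via-upperλ J-letters -[1+ a ] n r λ⁻ bound)

mLess-J : ∀ {B} → In123 B → mLess B J → ∃[ n₀ ] (∀ k n → lowerλ B k n <q lowerλ J (+ 0) n₀)
mLess-J {B} B-letters (c , d , _ , B≤c/d , k , n , c/d<Jkn) = n₀ , B<J₀
  where
  n₀ = proj₁ (J-λ-max k n)
  c/d<J₀ : (c , d) <q lowerλ J (+ 0) n₀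
  c/d<J₀ = <q-≤q-trans (c , d) (lowerλ J k n) (lowerλ J (+ 0) n₀)
             (lowerλ-denominator J-letters (+ 0) n₀) c/d<Jkn (proj₂ (J-λ-max k n))
  B<J₀ : ∀ k n → lowerλ B k n <q lowerλ J (+ 0) n₀
  B<J₀ k n = ≤q-<q-trans (lowerλ B k n) (c , d) (lowerλ J (+ 0) n₀)
               (lowerλ-denominator B-letters k n) (B≤c/d k n) c/d<J₀

module BelowJ {B : Seq} (B-letters : In123 B) {n₀ : ℕ}
              (B<J : ∀ k n → lowerλ B k n <q lowerλ J (+ 0) n₀) where

  window-not-above-θ : ∀ w → Around B w → ¬ (θ <q windowλ w)
  window-not-above-θ w around θ<w =
    <q-asym (lowerλ J (+ 0) n₀) (lowerλ B (centre w) n) J₀<B (B<J (centre w) n)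
    where
    n = proj₁ (windowλ≤lowerλ B-letters w around)
    J₀<w : lowerλ J (+ 0) n₀ <q windowλ w
    J₀<w = ≤q-<q-trans (lowerλ J (+ 0) n₀) θ (windowλ w) (lowerλ-denominator J-letters (+ 0) n₀)
             (subst (lowerλ J (+ 0) n₀ ≤q_) (sym θ-upperλ) (lowerλ≤upperλ J (+ 0) n₀ 16)) θ<w
    J₀<B : lowerλ J (+ 0) n₀ <q lowerλ B (centre w) n
    J₀<B = <q-≤q-trans (lowerλ J (+ 0) n₀) (windowλ w) (lowerλ B (centre w) n)
             (lowerλ-denominator B-letters (centre w) n) J₀<w (proj₂ (windowλ≤lowerλ B-letters w around))

  not-exceeds : ∀ k Q P → Around B (window k Q P) → ¬ Exceeds k Q P
  not-exceeds k Q []      around θ<w           = window-not-above-θ (window k Q []) around θ<w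
  not-exceeds k Q (x ∷ P) around (inj₁ θ<w)    = window-not-above-θ (window k Q (x ∷ P)) around θ<w
  not-exceeds k Q (x ∷ P) around (inj₂ further) =
    not-exceeds (ℤ.suc k) (x ∷ Q) P (Around-recentre B 1 (window k Q (x ∷ P)) around) further

  forced : ∀ lo W t → Valid lo W t → ReadsForward B lo W →
           ReadsForward B (-[1+ 19 ]) concWord ⊎ ReadsForward B (-[1+ 19 ]) jWin
  forced lo W conclusion  (refl , refl) reads = inj₁ reads
  forced lo W jWindow     (refl , refl) reads = inj₂ reads
  forced lo W (exceeds i) θ<            reads =
    ⊥-elim (window-not-above-θ _ (Around-recentre B i (window lo [] W) (tt , reads)) θ<)
  forced lo W (right t₁ t₂ t₃) (v₁ , v₂ , v₃) reads =
    letter-case (B-letters (iterate ℤ.suc lo (length W)))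
    (λ Bi≡1 → forced lo _ t₁ v₁ (Reads-∷ʳ ℤ.suc B lo W reads Bi≡1))
    (λ Bi≡2 → forced lo _ t₂ v₂ (Reads-∷ʳ ℤ.suc B lo W reads Bi≡2))
    (λ Bi≡3 → forced lo _ t₃ v₃ (Reads-∷ʳ ℤ.suc B lo W reads Bi≡3))
  forced lo W (left t₁ t₂ t₃) (v₁ , v₂ , v₃) reads = letter-case (B-letters (ℤ.pred lo))
    (λ Bi≡1 → forced (ℤ.pred lo) _ t₁ v₁ (ReadsForward-∷ B lo W reads Bi≡1))
    (λ Bi≡2 → forced (ℤ.pred lo) _ t₂ v₂ (ReadsForward-∷ B lo W reads Bi≡2))
    (λ Bi≡3 → forced (ℤ.pred lo) _ t₃ v₃ (ReadsForward-∷ B lo W reads Bi≡3))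

  module RightTail = PeriodicTail ℤ.suc J B (λ n → + (22 + n)) (λ _ → refl) J-letters B-letters
    (λ j → J-right (2 + j))
    (λ j B₀ B₁ B₂ B₃ → window-not-above-θ (window (+ (25 + j)) (1 ∷ 2 ∷ 1 ∷ []) (3 ∷ []))
                         ((B₂ , B₁ , B₀ , tt) , (B₃ , tt)) (θ<121∣3 (+ (25 + j))))

  module LeftTail = PeriodicTail ℤ.pred (J ∘ ℤ.pred) (B ∘ ℤ.pred) (λ n → -[1+ (42 + n) ]) (λ _ → refl)
    (J-letters ∘ ℤ.pred) (B-letters ∘ ℤ.pred) J-left
    (λ j B₀ B₁ B₂ B₃ → window-not-above-θ (window -[1+ (46 + j) ] [] (3 ∷ 1 ∷ 2 ∷ 1 ∷ []))
                         (tt , (B₃ , B₂ , B₁ , B₀ , tt)) (θ<∣3121 -[1+ (46 + j) ]))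

  -- J reads 1 2 at 22, 23 but B has read 2 1 before, so the periodic argument only starts at 24
  -- and the deviation B₂₃ = 3 is refuted together with the letter after it.
  right-of-jWin : ReadsForward B (-[1+ 19 ]) jWin → ∀ L → BelowAt ℤ.suc true J B (+ 22) L
  right-of-jWin reads zero    = belowAt-zero ℤ.suc true J B (+ 22)
  right-of-jWin reads (suc L) = letter-case (B-letters (+ 22))
    (λ B₂₂≡1 → belowAt-agree ℤ.suc true J B (+ 22) L (sym B₂₂≡1) (at-23 B₂₂≡1 L))
    (λ B₂₂≡2 → belowAt-< ℤ.suc J B (+ 22) (suc L) J-letters (subst (1 <_) (sym B₂₂≡2) 1<2))
    (λ B₂₂≡3 → belowAt-< ℤ.suc J B (+ 22) (suc L) J-letters (subst (1 <_) (sym B₂₂≡3) 1<3))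
    where
    at-23 : B (+ 22) ≡ 1 → ∀ L → BelowAt ℤ.suc false J B (+ 23) L
    at-23 B₂₂≡1 zero    = belowAt-zero ℤ.suc false J B (+ 23)
    at-23 B₂₂≡1 (suc L) = letter-case (B-letters (+ 23))
      (λ B₂₃≡1 → belowAt-< ℤ.suc B J (+ 23) (suc L) B-letters (subst (_< 2) (sym B₂₃≡1) 1<2))
      (λ B₂₃≡2 → belowAt-agree ℤ.suc false J B (+ 23) L (sym B₂₃≡2)
                   (RightTail.after-12 0 L refl B₂₂≡1 B₂₃≡2))
      (λ B₂₃≡3 → ⊥-elim (window-not-above-θ _
                   (Around-recentre B 43 (window (-[1+ 19 ]) [] (jWin ++ 1 ∷ 3 ∷ B (+ 24) ∷ []))
                     (tt , reads-jWin13 B₂₃≡3))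
                   (θ<jWin13 (B-letters (+ 24)))))
      where
      reads-jWin13 : B (+ 23) ≡ 3 → ReadsForward B (-[1+ 19 ]) (jWin ++ 1 ∷ 3 ∷ B (+ 24) ∷ [])
      reads-jWin13 B₂₃≡3 =
        Reads-∷ʳ ℤ.suc B _ _ (Reads-∷ʳ ℤ.suc B _ _ (Reads-∷ʳ ℤ.suc B _ jWin reads B₂₂≡1) B₂₃≡3)
          refl

  mutual
    left-sound : ∀ f lo W b → LeftCertificate f lo W b → ReadsForward B lo W →
                 ∀ L → BelowAt ℤ.pred b (B ∘ ℤ.pred) (J ∘ ℤ.pred) lo L
    left-sound f       lo W            b _ _ zero = belowAt-zero ℤ.pred b (B ∘ ℤ.pred) (J ∘ ℤ.pred) lo
    left-sound zero    lo (x ∷ y ∷ W) b (refl , refl , refl) (B₋₄₅≡2 , B₋₄₄≡1 , _) (suc L) =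
      LeftTail.after-12 0 (suc L) refl B₋₄₄≡1 B₋₄₅≡2
    left-sound (suc f) lo W            b certificate reads (suc L) =
      deviation-sound f lo W b (<-cmp (B (ℤ.pred lo)) (J (ℤ.pred lo)))
        (all-letters {P = λ x → Deviation f lo W b x (<-cmp x (J (ℤ.pred lo)))} certificate
                     (B-letters (ℤ.pred lo)))
        reads L

    deviation-sound : ∀ f lo W b c → Deviation f lo W b (B (ℤ.pred lo)) c → ReadsForward B lo W →
                      ∀ L → BelowAt ℤ.pred b (B ∘ ℤ.pred) (J ∘ ℤ.pred) lo (suc L)
    deviation-sound f lo W b     (tri≈ _ B≡J _) certificate reads L =
      belowAt-agree ℤ.pred b (B ∘ ℤ.pred) (J ∘ ℤ.pred) lo L B≡J
        (left-sound f (ℤ.pred lo) (B (ℤ.pred lo) ∷ W) (not b) certificate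
                    (ReadsForward-∷ B lo W reads refl) L)
    deviation-sound f lo W true  (tri< B<J _ _) _ reads L =
      belowAt-< ℤ.pred (B ∘ ℤ.pred) (J ∘ ℤ.pred) lo (suc L) (B-letters ∘ ℤ.pred) B<J
    deviation-sound f lo W false (tri> _ _ J<B) _ reads L =
      belowAt-< ℤ.pred (J ∘ ℤ.pred) (B ∘ ℤ.pred) lo (suc L) (J-letters ∘ ℤ.pred) J<B
    deviation-sound f lo W true  (tri> _ _ _) exceeding reads L =
      ⊥-elim (not-exceeds (ℤ.pred lo) [] (B (ℤ.pred lo) ∷ W) (tt , ReadsForward-∷ B lo W reads refl)
                          exceeding)
    deviation-sound f lo W false (tri< _ _ _) exceeding reads L =
      ⊥-elim (not-exceeds (ℤ.pred lo) [] (B (ℤ.pred lo) ∷ W) (tt , ReadsForward-∷ B lo W reads refl)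
                          exceeding)

  jWin-impossible : ¬ ReadsForward B (-[1+ 19 ]) jWin
  jWin-impossible reads = ≤q⇒≯q (lowerλ J (+ 0) n₀) (lowerλ B (+ 0) n₀)
    (lowerλ-mono J B (+ 0) n₀ forward-below backward-below) (B<J (+ 0) n₀)
    where
    centred : ∀ S → ReadsForward S (-[1+ 19 ]) jWin → Around S (recentre 20 (window (-[1+ 19 ]) [] jWin))
    centred S reads = Around-recentre S 20 (window (-[1+ 19 ]) [] jWin) (tt , reads)
    forward-below : ∀ L → BelowAt ℤ.suc true J B (+ 0) L
    forward-below = belowAt-agree-on ℤ.suc true J B (+ 0) _
      (proj₂ (centred J J-reads-jWin)) (proj₂ (centred B reads)) (right-of-jWin reads)
    backward-below : ∀ L → BelowAt ℤ.pred true (B ∘ ℤ.pred) (J ∘ ℤ.pred) (+ 0) L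
    backward-below = belowAt-agree-on ℤ.pred true (B ∘ ℤ.pred) (J ∘ ℤ.pred) (+ 0) _
      (proj₁ (centred B reads)) (proj₁ (centred J J-reads-jWin))
      (left-sound 25 (-[1+ 19 ]) jWin true left-certificate reads)

mainTheorem9 : (B : Seq) → In123 B → Matches B hypWord 10 → mLess B J → Matches B concWord 20
mainTheorem9 B B-letters hypothesis m[B]<m[J] =
  [ ReadsForward⇒Matches B concWord 20 , ⊥-elim ∘ jWin-impossible ]′
    (forced (-[1+ 9 ]) hypWord forcing forcing-valid (Matches⇒ReadsForward B hypWord 10 hypothesis))
  where
  n₀ = proj₁ (mLess-J B-letters m[B]<m[J])
  open BelowJ {B} B-letters {n₀} (proj₂ (mLess-J B-letters m[B]<m[J]))
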